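{- For every graph $G$, \[ \operatorname{cw}(G) \leq \operatorname{lcw}(G) \leq \operatorname{tcpw}(G) + 3 \leq \operatorname{tctd}(G) + 2 \leq \operatorname{td}(G) + 2. \]
   Context: Clique-expressions build labeled graphs from: introduce (single vertex with label $i$), disjoint union, relabel (all labels $i$ become $j$), and join (add all edges between labels $i \neq j$). A $k$-expression uses at most $k$ labels in every intermediate graph. $\operatorname{cw}(G)$ is the minimum $k$ such that some $k$-expression constructs $G$ (up to forgetting labels); a clique-expression is linear if in every union the second operand is a single vertex, and $\operatorname{lcw}(G)$ is the minimum $k$ over linear $k$-expressions. Two vertices $u,v$ are twins if $N(u)\setminus\{v\} = N(v)\setminus\{u\}$; $\Pi_{tc}(G)$ is the partition into twinclasses; the quotient graph $G/\Pi_{tc}(G)$ has the twinclasses as vertices, adjacent iff some of their vertices are adjacent in $G$. $\operatorname{tcpw}(G) = \operatorname{pw}(G/\Pi_{tc}(G))$ and $\operatorname{tctd}(G) = \operatorname{td}(G/\Pi_{tc}(G))$, where $\operatorname{pw}$ is pathwidth and $\operatorname{td}$ is treedepth (minimum depth of a rooted forest on the vertex set in which every edge joins an ancestor–descendant pair). -}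

module Defs where

open import Data.Nat using (ℕ; zero; suc; _≤_; _⊔_; _∸_; _≡ᵇ_)
open import Data.Fin using (Fin; splitAt) renaming (zero to fzero; suc to fsuc; _≤_ to _≤ᶠ_)
open import Data.Fin.Subset using (Subset; _∈_; ∣_∣)
open import Data.Bool using (Bool; true; false; _∧_; _∨_; if_then_else_)
open import Data.Maybe using (Maybe; just; nothing)
open import Data.List using (List; length)
open import Data.List.Membership.Propositional using () renaming (_∈_ to _∈ˡ_)
open import Data.Sum using (_⊎_; inj₁; inj₂)
open import Data.Product using (Σ; ∃; _×_; _,_)
open import Data.Unit using (⊤)
open import Function using (_∘_)
open import Function.Bundles using (_↔_; _⇔_; Inverse)
open import Relation.Binary.PropositionalEquality using (_≡_; _≢_)

record Graph : Set where
  field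
    n      : ℕ
    adj    : Fin n → Fin n → Bool
    sym    : ∀ u v → adj u v ≡ adj v u
    irrefl : ∀ u → adj u u ≡ false

open Graph public using () renaming (n to ∣V∣)

maxFin : ∀ {m} → (Fin m → ℕ) → ℕ
maxFin {zero}  f = 0
maxFin {suc m} f = f fzero ⊔ maxFin (f ∘ fsuc)

data CExpr : Set where
  intro   : ℕ → CExpr
  _⊕_     : CExpr → CExpr → CExpr
  relabel : ℕ → ℕ → CExpr → CExpr
  join    : ℕ → ℕ → CExpr → CExpr

size : CExpr → ℕ
size (intro _)       = 1
size (e₁ ⊕ e₂)       = size e₁ Data.Nat.+ size e₂
size (relabel _ _ e) = size e
size (join _ _ e)    = size e

record LGraph (n : ℕ) : Set where
  field
    lab : Fin n → ℕ
    adj : Fin n → Fin n → Bool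

eval : (e : CExpr) → LGraph (size e)
eval (intro i) = record { lab = λ _ → i ; adj = λ _ _ → false }
eval (e₁ ⊕ e₂) = record { lab = lab ; adj = adj }
  where
    g₁ = eval e₁
    g₂ = eval e₂
    lab : Fin (size e₁ Data.Nat.+ size e₂) → ℕ
    lab v with splitAt (size e₁) v
    ... | inj₁ x = LGraph.lab g₁ x
    ... | inj₂ y = LGraph.lab g₂ y
    adj : Fin (size e₁ Data.Nat.+ size e₂) → Fin (size e₁ Data.Nat.+ size e₂) → Bool
    adj u v with splitAt (size e₁) u | splitAt (size e₁) v
    ... | inj₁ x | inj₁ y = LGraph.adj g₁ x y
    ... | inj₂ x | inj₂ y = LGraph.adj g₂ x y
    ... | inj₁ _ | inj₂ _ = false
    ... | inj₂ _ | inj₁ _ = false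
eval (relabel i j e) = record
  { lab = λ v → if LGraph.lab g v ≡ᵇ i then j else LGraph.lab g v
  ; adj = LGraph.adj g }
  where g = eval e
eval (join i j e) = record
  { lab = LGraph.lab g
  ; adj = λ u v → LGraph.adj g u v
                  ∨ ((LGraph.lab g u ≡ᵇ i) ∧ (LGraph.lab g v ≡ᵇ j))
                  ∨ ((LGraph.lab g u ≡ᵇ j) ∧ (LGraph.lab g v ≡ᵇ i)) }
  where g = eval e

AtMostLabels : ℕ → ∀ {n} → LGraph n → Set
AtMostLabels k g = Σ (List ℕ) λ L → length L ≤ k × (∀ v → LGraph.lab g v ∈ˡ L)

KExpr : ℕ → CExpr → Set
KExpr k e = AtMostLabels k (eval e) × Sub e
  where
    Sub : CExpr → Set
    Sub (intro _)       = ⊤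
    Sub (e₁ ⊕ e₂)       = KExpr k e₁ × KExpr k e₂
    Sub (relabel _ _ e) = KExpr k e
    Sub (join i j e)    = i ≢ j × KExpr k e

Linear : CExpr → Set
Linear (intro _)       = ⊤
Linear (e₁ ⊕ e₂)       = Linear e₁ × size e₂ ≡ 1
Linear (relabel _ _ e) = Linear e
Linear (join _ _ e)    = Linear e

Constructs : CExpr → Graph → Set
Constructs e G =
  Σ (Fin (size e) ↔ Fin (∣V∣ G)) λ f →
    ∀ u v → LGraph.adj (eval e) u v ≡ Graph.adj G (Inverse.to f u) (Inverse.to f v)

HasKExpr : ℕ → Graph → Set
HasKExpr k G = Σ CExpr λ e → KExpr k e × Constructs e G

HasLinearKExpr : ℕ → Graph → Set
HasLinearKExpr k G = Σ CExpr λ e → KExpr k e × Linear e × Constructs e G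

IsCw : Graph → ℕ → Set
IsCw G c = HasKExpr c G × (∀ k → HasKExpr k G → c ≤ k)

IsLcw : Graph → ℕ → Set
IsLcw G c = HasLinearKExpr c G × (∀ k → HasLinearKExpr k G → c ≤ k)

record PathDecomposition (G : Graph) : Set where
  field
    m      : ℕ
    bag    : Fin m → Subset (∣V∣ G)
    cover  : ∀ v → ∃ λ i → v ∈ bag i
    edges  : ∀ u v → Graph.adj G u v ≡ true → ∃ λ i → u ∈ bag i × v ∈ bag i
    contig : ∀ v (i j k : Fin m) → i ≤ᶠ j → j ≤ᶠ k → v ∈ bag i → v ∈ bag k → v ∈ bag j

pdWidth : ∀ {G} → PathDecomposition G → ℕ
pdWidth P = maxFin (λ i → ∣ PathDecomposition.bag P i ∣) ∸ 1

IsPw : Graph → ℕ → Set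
IsPw G p = (Σ (PathDecomposition G) λ P → pdWidth P ≡ p)
         × (∀ (P : PathDecomposition G) → p ≤ pdWidth P)

-- rooted forest on Fin n given by a parent map; level v = number of
-- vertices on the path from v to its root (its existence forces acyclicity)
record RootedForest (n : ℕ) : Set where
  field
    parent      : Fin n → Maybe (Fin n)
    level       : Fin n → ℕ
    level-root  : ∀ v → parent v ≡ nothing → level v ≡ 1
    level-child : ∀ v w → parent v ≡ just w → level v ≡ suc (level w)

data Ancestor {n} (F : RootedForest n) : Fin n → Fin n → Set where
  self : ∀ {v} → Ancestor F v v
  up   : ∀ {u v w} → RootedForest.parent F v ≡ just w → Ancestor F u w → Ancestor F u v

forestDepth : ∀ {n} → RootedForest n → ℕ
forestDepth F = maxFin (RootedForest.level F)

IsTdForest : (G : Graph) → RootedForest (∣V∣ G) → Set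
IsTdForest G F = ∀ u v → Graph.adj G u v ≡ true → Ancestor F u v ⊎ Ancestor F v u

IsTd : Graph → ℕ → Set
IsTd G t = (Σ (RootedForest (∣V∣ G)) λ F → IsTdForest G F × forestDepth F ≡ t)
         × (∀ (F : RootedForest (∣V∣ G)) → IsTdForest G F → t ≤ forestDepth F)

Twins : (G : Graph) → Fin (∣V∣ G) → Fin (∣V∣ G) → Set
Twins G u v = ∀ w → (Graph.adj G u w ≡ true × w ≢ v) ⇔ (Graph.adj G v w ≡ true × w ≢ u)

IsTwinQuotient : Graph → Graph → Set
IsTwinQuotient G H =
  Σ (Fin (∣V∣ G) → Fin (∣V∣ H)) λ q →
      (∀ a → ∃ λ u → q u ≡ a)
    × (∀ u v → (q u ≡ q v) ⇔ Twins G u v)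
    × (∀ a b → (Graph.adj H a b ≡ true) ⇔
         (a ≢ b × ∃ λ u → ∃ λ v → q u ≡ a × q v ≡ b × Graph.adj G u v ≡ true))

IsTcpw : Graph → ℕ → Set
IsTcpw G p = Σ Graph λ H → IsTwinQuotient G H × IsPw H p

IsTctd : Graph → ℕ → Set
IsTctd G t = Σ Graph λ H → IsTwinQuotient G H × IsTd H t

-- cw ≤ lcw holds trivially.
--
-- lcw ≤ tcpw + 3: take a path decomposition of the twin quotient of width tcpw and insert the
-- vertices one at a time, ordered by the first bag containing their twin class. While bag c is
-- current, every vertex whose class lies in bag c carries a label naming its class, all other
-- vertices share the dead label 0, and label 1 is reserved for the vertex being inserted. Twins have
-- the same neighbours, so joining label 1 with the labels of the classes containing a neighbour of
-- the new vertex creates exactly its edges to earlier vertices; an earlier neighbour's class is still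
-- in the current bag by the contiguity of the decomposition. This uses |bag| + 2 labels.
--
-- tcpw + 1 ≤ tctd: order the vertices of a treedepth forest depth-first and keep every vertex in the
-- bags from its own position up to that of its last neighbour. Since every edge joins an ancestor and
-- a descendant, and the descendants of a vertex follow it immediately, each bag is an ancestor chain,
-- so it has at most depth many vertices.
--
-- tctd ≤ td: restricting a treedepth forest to one representative per twin class, the parent of a
-- representative being its nearest represented proper ancestor, yields a forest for the quotient,
-- because representatives of adjacent classes are themselves adjacent.

module Submission where

open import Defs
open import Data.Bool using (Bool; true; false; if_then_else_; _∧_; _∨_)
open import Data.Bool.Properties
  using (∨-assoc; ∨-comm; ∨-identityʳ; ∨-zeroʳ; ∧-identityʳ; ∧-zeroʳ) renaming (_≟_ to _≟ᴮ_)
open import Data.Empty using (⊥-elim)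
open import Data.Fin using (Fin; toℕ; fromℕ<; splitAt; _↑ˡ_; _↑ʳ_; _≟_)
  renaming (zero to fzero; suc to fsuc; join to fjoin)
open import Data.Fin.Properties
  using (any?; injective⇒≤; toℕ-injective; toℕ-fromℕ<; splitAt-↑ˡ; splitAt-↑ʳ; join-splitAt)
  renaming (suc-injective to fsuc-injective; ≤-decTotalOrder to ≤ᶠ-decTotalOrder)
open import Data.Fin.Subset using (Subset; _∈_; ∣_∣)
open import Data.Fin.Subset.Properties using (p⊆q⇒∣p∣≤∣q∣; p⊂q⇒∣p∣<∣q∣; ∣p∣≤n) renaming (_∈?_ to _∈ˢ?_)
open import Data.List using (List; []; _∷_; _++_; _∷ʳ_; [_]; initLast; _∷ʳ′_; length; map; filter; tabulate; allFin)
open import Data.List.Properties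
  using (++-identityʳ; ++-assoc; ∷ʳ-injective; ∷ʳ-injectiveˡ; ++-conicalˡ; ++-conicalʳ; length-tabulate)
open import Data.List.Membership.Propositional using () renaming (_∈_ to _∈ˡ_)
import Data.List.Membership.Propositional.Properties as ∈ˡ
open import Data.List.Relation.Unary.Any using () renaming (here to hereˡ; there to thereˡ)
open import Data.List.Relation.Unary.All using (All; []; _∷_)
import Data.List.Relation.Unary.All as All
import Data.List.Relation.Unary.All.Properties as All
open import Data.List.Relation.Unary.AllPairs using (AllPairs; []; _∷_)
open import Data.List.Relation.Unary.Linked.Properties using (Linked⇒AllPairs)
open import Data.List.Relation.Unary.Unique.Propositional using (Unique)
open import Data.List.Relation.Unary.Unique.Propositional.Properties using (allFin⁺)
open import Data.List.Relation.Binary.Lex.Strict using (Lex-<; this; next; halt)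
import Data.List.Relation.Binary.Lex.Strict as Lex
open import Data.List.Relation.Binary.Pointwise using (Pointwise-≡⇒≡; ≡⇒Pointwise-≡)
open import Data.List.Relation.Binary.Permutation.Propositional using (↭-sym; ↭⇒↭ₛ)
open import Data.List.Relation.Binary.Permutation.Propositional.Properties using (∈-resp-↭)
import Data.List.Relation.Binary.Permutation.Setoid.Properties as Permutationₛ
import Data.List.Sort
open import Data.Maybe using (Maybe; just; nothing)
import Data.Maybe as Maybe
open import Data.Maybe.Properties using (just-injective)
open import Data.Nat using (ℕ; zero; suc; _≤_; _<_; _+_; _∸_; z≤n; s≤s; _≡ᵇ_; _≤?_)
import Data.Nat as ℕ
open import Data.List.Membership.DecPropositional ℕ._≟_ using () renaming (_∈?_ to _∈ˡ?_)
open import Data.Nat.Properties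
  using ( ≤-refl; ≤-reflexive; ≤-trans; ≤-antisym; ≤-total; <-irrefl; <-cmp; <⇒≱; 1+n≰n; m<n⇒m<1+n
        ; suc-injective; +-assoc; +-comm; +-identityʳ; +-mono-≤; +-monoˡ-≤; +-monoʳ-≤
        ; m≤m⊔n; m≤n⊔m; ⊔-lub; m≤n+m∸n; m∸n+n≡m; ∸-monoˡ-≤; ∸-cancelʳ-≡; <-strictTotalOrder
        ; module ≤-Reasoning)
open import Data.Product using (Σ; ∃; _×_; _,_; proj₁; proj₂; map₂)
open import Data.Sum using (_⊎_; inj₁; inj₂) renaming (map to map⊎)
open import Data.Unit using (tt)
open import Data.Vec using ([]; _∷_; here; there) renaming (tabulate to tabulateᵛ)
open import Data.Vec.Properties using (lookup∘tabulate; []=⇒lookup; lookup⇒[]=)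
open import Data.Vec.Functional using (updateAt)
open import Data.Vec.Functional.Properties using (updateAt-updates; updateAt-minimal)
open import Function using (_∘_)
open import Function.Bundles using (Equivalence; Inverse; _⇔_; mk⇔; mk↔ₛ′)
import Relation.Binary.Construct.On as On
open import Relation.Binary.Bundles using (StrictTotalOrder)
open import Relation.Binary.Definitions using (tri<; tri≈; tri>)
open import Relation.Binary.PropositionalEquality hiding ([_])
open import Relation.Nullary using (Dec; yes; no; does; ¬_; ¬?)
open import Relation.Nullary.Decidable using (dec-true; dec-false; does-⇔; _×-dec_; _⊎-dec_)
open import Relation.Unary using (Decidable)

maxFin-upperBound : ∀ {m} (f : Fin m → ℕ) i → f i ≤ maxFin f
maxFin-upperBound f fzero    = m≤m⊔n _ _
maxFin-upperBound f (fsuc i) = ≤-trans (maxFin-upperBound (f ∘ fsuc) i) (m≤n⊔m _ _)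

maxFin-least : ∀ {m} (f : Fin m → ℕ) {b} → (∀ i → f i ≤ b) → maxFin f ≤ b
maxFin-least {zero}  f h = z≤n
maxFin-least {suc m} f h = ⊔-lub (h fzero) (maxFin-least (f ∘ fsuc) (h ∘ fsuc))

does⇒ : ∀ {a} {A : Set a} (d : Dec A) → does d ≡ true → A
does⇒ (yes a) _ = a

does≡ : ∀ {a} {A : Set a} (d : Dec A) {b} → A ⇔ (b ≡ true) → does d ≡ b
does≡ d {true}  A⇔b = does-⇔ A⇔b d (true ≟ᴮ true)
does≡ d {false} A⇔b = does-⇔ A⇔b d (false ≟ᴮ true)

leastIndex : ∀ {m p} {P : Fin m → Set p} → Decidable P → ∃ P
  → ∃ λ i → P i × (∀ {j} → P j → toℕ i ≤ toℕ j)
leastIndex {suc m} P? ex with P? fzero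
... | yes p₀ = fzero , p₀ , λ _ → z≤n
... | no ¬p₀ with ex
...   | fzero  , p = ⊥-elim (¬p₀ p)
...   | fsuc i , p with leastIndex (P? ∘ fsuc) (i , p)
...     | j , pj , least = fsuc j , pj , λ { {fzero} p₀ → ⊥-elim (¬p₀ p₀) ; {fsuc j′} pj′ → s≤s (least pj′) }

enumerate : ∀ {n} (S : Subset n) → Fin ∣ S ∣ → Fin n
enumerate (true ∷ S)  fzero    = fzero
enumerate (true ∷ S)  (fsuc i) = fsuc (enumerate S i)
enumerate (false ∷ S) i        = fsuc (enumerate S i)

enumerate-∈ : ∀ {n} (S : Subset n) i → enumerate S i ∈ S
enumerate-∈ (true ∷ S)  fzero    = here
enumerate-∈ (true ∷ S)  (fsuc i) = there (enumerate-∈ S i)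
enumerate-∈ (false ∷ S) i        = there (enumerate-∈ S i)

enumerate-injective : ∀ {n} (S : Subset n) {i j} → enumerate S i ≡ enumerate S j → i ≡ j
enumerate-injective (true ∷ S)  {fzero}  {fzero}  _ = refl
enumerate-injective (true ∷ S)  {fsuc i} {fsuc j} e = cong fsuc (enumerate-injective S (fsuc-injective e))
enumerate-injective (false ∷ S) e = enumerate-injective S (fsuc-injective e)

enumerate-onto : ∀ {n} (S : Subset n) {x} → x ∈ S → ∃ λ i → enumerate S i ≡ x
enumerate-onto (true ∷ S)  here      = fzero , refl
enumerate-onto (true ∷ S)  (there p) with enumerate-onto S p
... | i , refl = fsuc i , refl
enumerate-onto (false ∷ S) (there p) with enumerate-onto S p
... | i , refl = i , refl

∣S∣≤-injectiveOn : ∀ {n t} (S : Subset n) (g : Fin n → Fin t)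
  → (∀ {u v} → u ∈ S → v ∈ S → g u ≡ g v → u ≡ v) → ∣ S ∣ ≤ t
∣S∣≤-injectiveOn S g inj =
  injective⇒≤ λ e → enumerate-injective S (inj (enumerate-∈ S _) (enumerate-∈ S _) e)

decSubset : ∀ {n p} {P : Fin n → Set p} → Decidable P → Subset n
decSubset P? = tabulateᵛ (does ∘ P?)

∈-decSubset⁺ : ∀ {n p} {P : Fin n → Set p} (P? : Decidable P) {x} → P x → x ∈ decSubset P?
∈-decSubset⁺ P? {x} px = lookup⇒[]= x _ (trans (lookup∘tabulate _ x) (dec-true (P? x) px))

∈-decSubset⁻ : ∀ {n p} {P : Fin n → Set p} (P? : Decidable P) {x} → x ∈ decSubset P? → P x
∈-decSubset⁻ P? {x} m = does⇒ (P? x) (trans (sym (lookup∘tabulate _ x)) ([]=⇒lookup m))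

≡ᵇ-refl : ∀ m → (m ≡ᵇ m) ≡ true
≡ᵇ-refl m = dec-true (m ℕ.≟ m) refl

≢⇒≡ᵇ-false : ∀ {m n} → m ≢ n → (m ≡ᵇ n) ≡ false
≢⇒≡ᵇ-false {m} {n} = dec-false (m ℕ.≟ n)

∨-swap : ∀ a b c → (a ∨ b) ∨ c ≡ a ∨ (c ∨ b)
∨-swap a b c = trans (∨-assoc a b c) (cong (a ∨_) (∨-comm b c))

_<ₗ_ : List ℕ → List ℕ → Set
_<ₗ_ = Lex-< _≡_ _<_

prefix-squeeze : ∀ xs zs β → ¬ (zs <ₗ xs) → ¬ ((xs ++ β) <ₗ zs) → ∃ λ γ → zs ≡ xs ++ γ
prefix-squeeze []       zs       β _ _ = zs , refl
prefix-squeeze (x ∷ xs) []       β zs≮xs _ = ⊥-elim (zs≮xs halt)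
prefix-squeeze (x ∷ xs) (z ∷ zs) β zs≮xs xsβ≮zs with <-cmp x z
... | tri< x<z _ _ = ⊥-elim (xsβ≮zs (this x<z))
... | tri> _ _ z<x = ⊥-elim (zs≮xs (this z<x))
... | tri≈ _ refl _ = map₂ (cong (x ∷_))
        (prefix-squeeze xs zs β (zs≮xs ∘ next refl) (xsβ≮zs ∘ next refl))

module Lexₗ = StrictTotalOrder (Lex.<-strictTotalOrder <-strictTotalOrder)

<ₗ-irrefl : ∀ {xs} → ¬ (xs <ₗ xs)
<ₗ-irrefl = Lexₗ.irrefl (≡⇒Pointwise-≡ refl)

<ₗ-≤ₗ-trans : ∀ {xs ys zs} → xs <ₗ ys → ¬ (zs <ₗ ys) → xs <ₗ zs
<ₗ-≤ₗ-trans {ys = ys} {zs} xs<ys zs≮ys with Lexₗ.compare ys zs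
... | tri< ys<zs _ _ = Lexₗ.trans xs<ys ys<zs
... | tri≈ _ ys≈zs _ = subst (_ <ₗ_) (Pointwise-≡⇒≡ ys≈zs) xs<ys
... | tri> _ _ zs<ys = ⊥-elim (zs≮ys zs<ys)

++-≮ₗ : ∀ xs β → ¬ ((xs ++ β) <ₗ xs)
++-≮ₗ (x ∷ xs) β (this x<x)  = <-irrefl refl x<x
++-≮ₗ (x ∷ xs) β (next _ l) = ++-≮ₗ xs β l

module _ {n} (F : RootedForest n) where
  open RootedForest F

  level-positive : ∀ v → 1 ≤ level v
  level-positive v with parent v in p
  ... | nothing = ≤-reflexive (sym (level-root v p))
  ... | just w  = ≤-trans (s≤s z≤n) (≤-reflexive (sym (level-child v w p)))

  ancestor-level : ∀ {x y} → Ancestor F x y → x ≡ y ⊎ level x < level y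
  ancestor-level self = inj₁ refl
  ancestor-level (up {v = y} {w = w} p A) rewrite level-child y w p with ancestor-level A
  ... | inj₁ refl = inj₂ ≤-refl
  ... | inj₂ l    = inj₂ (m<n⇒m<1+n l)

  forest-induction : ∀ {p} (P : Fin n → Set p)
    → (∀ v → parent v ≡ nothing → P v)
    → (∀ v w → parent v ≡ just w → P w → P v)
    → ∀ v → P v
  forest-induction P root child v = go (level v) v refl
    where
    go : ∀ k v → level v ≡ k → P v
    go k v lv with parent v in p
    ... | nothing = root v p
    go zero    v lv | just w = ⊥-elim (1+n≰n (≤-trans (level-positive v) (≤-reflexive lv)))
    go (suc k) v lv | just w = child v w p (go k w (suc-injective (trans (sym (level-child v w p)) lv)))

  level∸1<depth : ∀ v → level v ∸ 1 < forestDepth F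
  level∸1<depth v with level v | level-positive v | maxFin-upperBound level v
  ... | suc l | _ | l<depth = l<depth

  module _ {B : Set} (f : Fin n → Maybe B → B) where

    -- the level serves as fuel: it strictly decreases along parent pointers
    foldToRoot′ : ℕ → Fin n → B
    foldToRoot′ zero    v = f v nothing
    foldToRoot′ (suc k) v = f v (Maybe.map (foldToRoot′ k) (parent v))

    foldToRoot : Fin n → B
    foldToRoot v = foldToRoot′ (level v) v

    foldToRoot-unfold : ∀ v → ∃ λ r → foldToRoot v ≡ f v r
    foldToRoot-unfold v with level v
    ... | zero  = nothing , refl
    ... | suc k = _ , refl

    foldToRoot-root : ∀ {v} → parent v ≡ nothing → foldToRoot v ≡ f v nothing
    foldToRoot-root {v} p rewrite level-root v p | p = refl

    foldToRoot-child : ∀ {v w} → parent v ≡ just w → foldToRoot v ≡ f v (just (foldToRoot w))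
    foldToRoot-child {v} {w} p rewrite level-child v w p | p = refl

depth-positive : ∀ {N} (F : RootedForest N) → Fin N → 1 ≤ forestDepth F
depth-positive F v = ≤-trans (level-positive F v) (maxFin-upperBound (RootedForest.level F) v)

module RootPaths {n} (F : RootedForest n) where
  open RootedForest F

  pathStep : Fin n → Maybe (List ℕ) → List ℕ
  pathStep v r = Maybe.maybe (λ p → p) [] r ∷ʳ toℕ v

  -- toℕ of the vertices on the path from the root down to v, root first
  rootPath : Fin n → List ℕ
  rootPath = foldToRoot F pathStep

  rootPath-injective : ∀ {u v} → rootPath u ≡ rootPath v → u ≡ v
  rootPath-injective {u} {v} e with foldToRoot-unfold F pathStep u | foldToRoot-unfold F pathStep v
  ... | r , eu | s , ev = toℕ-injective (proj₂ (∷ʳ-injective _ _ (trans (sym eu) (trans e ev))))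

  rootPath-nonempty : ∀ v → rootPath v ≢ []
  rootPath-nonempty v e with foldToRoot-unfold F pathStep v
  ... | r , ev with ++-conicalʳ (Maybe.maybe (λ p → p) [] r) [ toℕ v ] (trans (sym ev) e)
  ...   | ()

  ancestor⇒prefix : ∀ {u v} → Ancestor F u v → ∃ λ β → rootPath v ≡ rootPath u ++ β
  ancestor⇒prefix {u} self = [] , sym (++-identityʳ (rootPath u))
  ancestor⇒prefix {u} (up {v = v} p A) with ancestor⇒prefix A
  ... | β , e = β ∷ʳ toℕ v , (begin
    rootPath v                      ≡⟨ foldToRoot-child F pathStep p ⟩
    rootPath _ ∷ʳ toℕ v             ≡⟨ cong (_∷ʳ toℕ v) e ⟩
    (rootPath u ++ β) ∷ʳ toℕ v      ≡⟨ ++-assoc (rootPath u) β [ toℕ v ] ⟩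
    rootPath u ++ β ∷ʳ toℕ v        ∎)
    where open ≡-Reasoning

  prefix⇒ancestor : ∀ v u β → rootPath v ≡ rootPath u ++ β → Ancestor F u v
  prefix⇒ancestor = forest-induction F _ root child
    where
    unsnoc : ∀ {xs ys} u β′ x → xs ∷ʳ toℕ ys ≡ rootPath u ++ β′ ∷ʳ x → xs ≡ rootPath u ++ β′
    unsnoc u β′ x e = ∷ʳ-injectiveˡ _ _ (trans e (sym (++-assoc (rootPath u) β′ [ x ])))

    same : ∀ v u → rootPath v ≡ rootPath u ++ [] → Ancestor F u v
    same v u e = subst (Ancestor F u) (rootPath-injective (sym (trans e (++-identityʳ _)))) self

    root : ∀ v → parent v ≡ nothing → ∀ u β → rootPath v ≡ rootPath u ++ β → Ancestor F u v
    root v p u β e with initLast β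
    ... | []        = same v u e
    ... | β′ ∷ʳ′ x  = ⊥-elim (rootPath-nonempty u (++-conicalˡ (rootPath u) β′
                        (sym (unsnoc {xs = []} {ys = v} u β′ x (trans (sym (foldToRoot-root F pathStep p)) e)))))

    child : ∀ v w → parent v ≡ just w → (∀ u β → rootPath w ≡ rootPath u ++ β → Ancestor F u w)
          → ∀ u β → rootPath v ≡ rootPath u ++ β → Ancestor F u v
    child v w p ih u β e with initLast β
    ... | []       = same v u e
    ... | β′ ∷ʳ′ x = up p (ih u β′ (unsnoc {ys = v} u β′ x (trans (sym (foldToRoot-child F pathStep p)) e)))

-- Treedepth of the twin quotient

module ImageForest {n K} (F : RootedForest n) (ι : Fin K → Fin n) (ρ : Fin n → Fin K)
                   (ρ∘ι : ∀ a → ρ (ι a) ≡ a) where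
  open RootedForest F

  inImage : Fin n → Bool
  inImage x = does (ι (ρ x) ≟ x)

  inImage-ι : ∀ a → inImage (ι a) ≡ true
  inImage-ι a with ι (ρ (ι a)) ≟ ι a
  ... | yes _ = refl
  ... | no ne = ⊥-elim (ne (cong ι (ρ∘ι a)))

  ι∘ρ : ∀ {x} → inImage x ≡ true → ι (ρ x) ≡ x
  ι∘ρ {x} = does⇒ (ι (ρ x) ≟ x)

  nearestStep : Fin n → Maybe (Maybe (Fin n)) → Maybe (Fin n)
  nearestStep v r = if inImage v then just v else Maybe.maybe (λ z → z) nothing r

  depthStep : Fin n → Maybe ℕ → ℕ
  depthStep v r = (if inImage v then 1 else 0) + Maybe.maybe (λ d → d) 0 r

  nearestImage : Fin n → Maybe (Fin n)
  nearestImage = foldToRoot F nearestStep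

  imageDepth : Fin n → ℕ
  imageDepth = foldToRoot F depthStep

  nearestImage-self : ∀ {v} → inImage v ≡ true → nearestImage v ≡ just v
  nearestImage-self {v} i with foldToRoot-unfold F nearestStep v
  ... | _ , e rewrite i = e

  imageDepth-nothing : ∀ v → nearestImage v ≡ nothing → imageDepth v ≡ 0
  imageDepth-nothing = forest-induction F _ root child
    where
    root : ∀ v → parent v ≡ nothing → nearestImage v ≡ nothing → imageDepth v ≡ 0
    root v p h with trans (sym (foldToRoot-root F nearestStep p)) h
    ... | h′ rewrite foldToRoot-root F depthStep p with inImage v
    ...   | false = refl
    child : ∀ v w → parent v ≡ just w → (nearestImage w ≡ nothing → imageDepth w ≡ 0)
          → nearestImage v ≡ nothing → imageDepth v ≡ 0
    child v w p ih h with trans (sym (foldToRoot-child F nearestStep p)) h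
    ... | h′ rewrite foldToRoot-child F depthStep p with inImage v
    ...   | false = ih h′

  imageDepth-just : ∀ v {z} → nearestImage v ≡ just z → inImage z ≡ true × imageDepth v ≡ imageDepth z
  imageDepth-just = forest-induction F _ root child
    where
    root : ∀ v → parent v ≡ nothing → ∀ {z} → nearestImage v ≡ just z → inImage z ≡ true × imageDepth v ≡ imageDepth z
    root v p h with trans (sym (foldToRoot-root F nearestStep p)) h
    ... | h′ with inImage v in i
    ...   | true with refl ← h′ = i , refl
    child : ∀ v w → parent v ≡ just w
          → (∀ {z} → nearestImage w ≡ just z → inImage z ≡ true × imageDepth w ≡ imageDepth z)
          → ∀ {z} → nearestImage v ≡ just z → inImage z ≡ true × imageDepth v ≡ imageDepth z
    child v w p ih h with trans (sym (foldToRoot-child F nearestStep p)) h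
    ... | h′ with inImage v in i
    ...   | true with refl ← h′ = i , refl
    ...   | false rewrite foldToRoot-child F depthStep p | i = ih h′

  inImage≤1 : ∀ v → (if inImage v then 1 else 0) ≤ 1
  inImage≤1 v with inImage v
  ... | true  = ≤-refl
  ... | false = z≤n

  imageDepth≤level : ∀ v → imageDepth v ≤ level v
  imageDepth≤level = forest-induction F _ root child
    where
    root : ∀ v → parent v ≡ nothing → imageDepth v ≤ level v
    root v p rewrite foldToRoot-root F depthStep p | level-root v p | +-identityʳ (if inImage v then 1 else 0) = inImage≤1 v
    child : ∀ v w → parent v ≡ just w → imageDepth w ≤ level w → imageDepth v ≤ level v
    child v w p ih rewrite foldToRoot-child F depthStep p | level-child v w p = +-mono-≤ (inImage≤1 v) ih

  imageParent : Fin K → Maybe (Fin K)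
  imageParent a = Maybe.map ρ (parent (ι a) Maybe.>>= nearestImage)

  imageLevel : Fin K → ℕ
  imageLevel a = imageDepth (ι a)

  imageLevel-root : ∀ a → imageParent a ≡ nothing → imageLevel a ≡ 1
  imageLevel-root a h with parent (ι a) in p
  ... | nothing rewrite foldToRoot-root F depthStep p | inImage-ι a = refl
  ... | just w with nearestImage w in e
  ...   | nothing rewrite foldToRoot-child F depthStep p | inImage-ι a = cong suc (imageDepth-nothing w e)

  imageLevel-child : ∀ a b → imageParent a ≡ just b → imageLevel a ≡ suc (imageLevel b)
  imageLevel-child a b h with parent (ι a) in p
  ... | just w with nearestImage w in e
  ...   | just z with refl ← h rewrite foldToRoot-child F depthStep p | inImage-ι a
    with imageDepth-just w e
  ...     | iz , d rewrite ι∘ρ iz = cong suc d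

  imageForest : RootedForest K
  imageForest = record
    { parent = imageParent ; level = imageLevel
    ; level-root = imageLevel-root ; level-child = imageLevel-child }

  imageForest-depth : forestDepth imageForest ≤ forestDepth F
  imageForest-depth = maxFin-least imageLevel λ a →
    ≤-trans (imageDepth≤level (ι a)) (maxFin-upperBound level (ι a))

  ancestor-nearestImage : ∀ {x y} → Ancestor F x y → inImage x ≡ true
    → ∃ λ z → nearestImage y ≡ just z × Ancestor imageForest (ρ x) (ρ z)
  ancestor-nearestImage {x} self ix = x , nearestImage-self ix , self
  ancestor-nearestImage (up {v = y} {w = w} p A) ix with ancestor-nearestImage A ix
  ... | z , nz , A′ with inImage y in iy
  ...   | true = y , nearestImage-self iy , up parent′ A′
    where
    parent′ : imageParent (ρ y) ≡ just (ρ z)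
    parent′ rewrite ι∘ρ iy | p | nz = refl
  ...   | false rewrite foldToRoot-child F nearestStep p | iy = z , nz , A′

  ancestor-image : ∀ {a b} → Ancestor F (ι a) (ι b) → Ancestor imageForest a b
  ancestor-image {a} {b} A with ancestor-nearestImage A (inImage-ι a)
  ... | z , nz , A′ with refl ← just-injective (trans (sym (nearestImage-self (inImage-ι b))) nz) =
    subst₂ (Ancestor imageForest) (ρ∘ι a) (ρ∘ι b) A′

tdForest-subgraph : (G H : Graph) (ι : Fin (∣V∣ H) → Fin (∣V∣ G)) (ρ : Fin (∣V∣ G) → Fin (∣V∣ H))
  → (∀ a → ρ (ι a) ≡ a)
  → (∀ a b → Graph.adj H a b ≡ true → Graph.adj G (ι a) (ι b) ≡ true)
  → (F : RootedForest (∣V∣ G)) → IsTdForest G F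
  → Σ (RootedForest (∣V∣ H)) λ F′ → IsTdForest H F′ × forestDepth F′ ≤ forestDepth F
tdForest-subgraph G H ι ρ ρ∘ι edge F tdF =
  imageForest , (λ a b h → map⊎ ancestor-image ancestor-image (tdF (ι a) (ι b) (edge a b h)))
  , imageForest-depth
  where open ImageForest F ι ρ ρ∘ι

Twins-adj : ∀ G {u u′ w} → Twins G u u′ → Graph.adj G u w ≡ true → w ≢ u′ → Graph.adj G u′ w ≡ true
Twins-adj G {w = w} t a w≢u′ = proj₁ (Equivalence.to (t w) (a , w≢u′))

module TwinQuotient (G H : Graph) (Q : IsTwinQuotient G H) where
  q : Fin (∣V∣ G) → Fin (∣V∣ H)
  q = proj₁ Q

  rep : Fin (∣V∣ H) → Fin (∣V∣ G)
  rep a = proj₁ (proj₁ (proj₂ Q) a)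

  q∘rep : ∀ a → q (rep a) ≡ a
  q∘rep a = proj₂ (proj₁ (proj₂ Q) a)

  q≡⇒Twins : ∀ {u v} → q u ≡ q v → Twins G u v
  q≡⇒Twins = Equivalence.to (proj₁ (proj₂ (proj₂ Q)) _ _)

  Twins⇒q≡ : ∀ {u v} → Twins G u v → q u ≡ q v
  Twins⇒q≡ = Equivalence.from (proj₁ (proj₂ (proj₂ Q)) _ _)

  adjH⇒ : ∀ {a b} → Graph.adj H a b ≡ true
    → a ≢ b × ∃ λ u → ∃ λ v → q u ≡ a × q v ≡ b × Graph.adj G u v ≡ true
  adjH⇒ = Equivalence.to (proj₂ (proj₂ (proj₂ Q)) _ _)

  adjG⇒adjH : ∀ {u v} → q u ≢ q v → Graph.adj G u v ≡ true → Graph.adj H (q u) (q v) ≡ true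
  adjG⇒adjH {u} {v} ne a = Equivalence.from (proj₂ (proj₂ (proj₂ Q)) _ _) (ne , u , v , refl , refl , a)

  -- by the twin property, any two members of distinct adjacent classes are adjacent
  adjH⇒adj-rep : ∀ {a b} → Graph.adj H a b ≡ true → Graph.adj G (rep a) (rep b) ≡ true
  adjH⇒adj-rep {a} {b} h with adjH⇒ h
  ... | a≢b , u , v , refl , refl , auv = trans (Graph.sym G (rep a) (rep b)) rep-b~rep-a
    where
    rep-a~v : Graph.adj G (rep a) v ≡ true
    rep-a~v = Twins-adj G (q≡⇒Twins (sym (q∘rep a))) auv λ e → a≢b (sym (trans (cong q e) (q∘rep a)))
    rep-b~rep-a : Graph.adj G (rep b) (rep a) ≡ true
    rep-b~rep-a = Twins-adj G (q≡⇒Twins (sym (q∘rep b))) (trans (Graph.sym G v (rep a)) rep-a~v)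
      λ e → a≢b (trans (sym (q∘rep a)) (trans (cong q e) (q∘rep b)))

tdForest-twinQuotient : ∀ G H → IsTwinQuotient G H → (F : RootedForest (∣V∣ G)) → IsTdForest G F
  → Σ (RootedForest (∣V∣ H)) λ F′ → IsTdForest H F′ × forestDepth F′ ≤ forestDepth F
tdForest-twinQuotient G H Q = tdForest-subgraph G H rep q q∘rep (λ _ _ → adjH⇒adj-rep)
  where open TwinQuotient G H Q

twinQuotient-embedding : ∀ G H₁ H₂ → IsTwinQuotient G H₁ → IsTwinQuotient G H₂
  → Σ (Fin (∣V∣ H₁) → Fin (∣V∣ H₂)) λ φ → (∀ {a b} → φ a ≡ φ b → a ≡ b)
      × (∀ a b → Graph.adj H₁ a b ≡ true → Graph.adj H₂ (φ a) (φ b) ≡ true)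
twinQuotient-embedding G H₁ H₂ Q₁ Q₂ = φ , φ-injective , φ-edge
  where
  module Q₁ = TwinQuotient G H₁ Q₁
  module Q₂ = TwinQuotient G H₂ Q₂

  φ : Fin (∣V∣ H₁) → Fin (∣V∣ H₂)
  φ a = Q₂.q (Q₁.rep a)

  φ-injective : ∀ {a b} → φ a ≡ φ b → a ≡ b
  φ-injective {a} {b} e = trans (sym (Q₁.q∘rep a)) (trans (Q₁.Twins⇒q≡ (Q₂.q≡⇒Twins e)) (Q₁.q∘rep b))

  q₂≡φ∘q₁ : ∀ u → Q₂.q u ≡ φ (Q₁.q u)
  q₂≡φ∘q₁ u = Q₂.Twins⇒q≡ (Q₁.q≡⇒Twins (sym (Q₁.q∘rep (Q₁.q u))))

  φ-edge : ∀ a b → Graph.adj H₁ a b ≡ true → Graph.adj H₂ (φ a) (φ b) ≡ true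
  φ-edge a b h with Q₁.adjH⇒ h
  ... | a≢b , u , v , refl , refl , auv =
    subst₂ (λ x y → Graph.adj H₂ x y ≡ true) (q₂≡φ∘q₁ u) (q₂≡φ∘q₁ v)
      (Q₂.adjG⇒adjH (λ e → a≢b (φ-injective (trans (sym (q₂≡φ∘q₁ u)) (trans e (q₂≡φ∘q₁ v))))) auv)

-- Path decompositions from treedepth forests

module ForestPathDecomposition (H : Graph) {N} (F : RootedForest N) (φ : Fin (∣V∣ H) → Fin N)
  (φ-injective : ∀ {a b} → φ a ≡ φ b → a ≡ b)
  (φ-edge : ∀ a b → Graph.adj H a b ≡ true → Ancestor F (φ a) (φ b) ⊎ Ancestor F (φ b) (φ a)) where
  open RootedForest F
  open RootPaths F

  n : ℕ
  n = ∣V∣ H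

  key : Fin n → List ℕ
  key a = rootPath (φ a)

  below : Fin n → Subset n
  below v = decSubset λ w → key w Lexₗ.<? key v

  ∈-below⁺ : ∀ {v w} → key w <ₗ key v → w ∈ below v
  ∈-below⁺ {v} = ∈-decSubset⁺ λ w → key w Lexₗ.<? key v

  ∈-below⁻ : ∀ {v w} → w ∈ below v → key w <ₗ key v
  ∈-below⁻ {v} = ∈-decSubset⁻ λ w → key w Lexₗ.<? key v

  -- position of v in the depth-first order of the forest
  rank : Fin n → ℕ
  rank v = ∣ below v ∣

  rank-≤ : ∀ {u v} → ¬ (key v <ₗ key u) → rank u ≤ rank v
  rank-≤ v≮u = p⊆q⇒∣p∣≤∣q∣ λ m → ∈-below⁺ (<ₗ-≤ₗ-trans (∈-below⁻ m) v≮u)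

  rank-< : ∀ {u v} → key u <ₗ key v → rank u < rank v
  rank-< {u} u<v = p⊂q⇒∣p∣<∣q∣
    ( (λ m → ∈-below⁺ (Lexₗ.trans (∈-below⁻ m) u<v))
    , u , ∈-below⁺ u<v , λ m → <ₗ-irrefl (∈-below⁻ {u} m))

  rank-≤⁻ : ∀ {u v} → rank u ≤ rank v → ¬ (key v <ₗ key u)
  rank-≤⁻ le v<u = <⇒≱ (rank-< v<u) le

  InBag : ℕ → Fin n → Set
  InBag r u = rank u ≤ r × (rank u ≡ r ⊎ ∃ λ w → Graph.adj H u w ≡ true × r ≤ rank w)

  InBag? : ∀ r → Decidable (InBag r)
  InBag? r u = (rank u ≤? r) ×-dec ((rank u ℕ.≟ r) ⊎-dec any? λ w → (Graph.adj H u w ≟ᴮ true) ×-dec (r ≤? rank w))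

  bag : Fin (suc n) → Subset n
  bag r = decSubset (InBag? (toℕ r))

  ∈-bag⁺ : ∀ {r v} → InBag (toℕ r) v → v ∈ bag r
  ∈-bag⁺ {r} = ∈-decSubset⁺ (InBag? (toℕ r))

  ∈-bag⁻ : ∀ {r v} → v ∈ bag r → InBag (toℕ r) v
  ∈-bag⁻ {r} = ∈-decSubset⁻ (InBag? (toℕ r))

  rankIndex : Fin n → Fin (suc n)
  rankIndex v = fromℕ< (s≤s (∣p∣≤n (below v)))

  toℕ-rankIndex : ∀ v → toℕ (rankIndex v) ≡ rank v
  toℕ-rankIndex v = toℕ-fromℕ< (s≤s (∣p∣≤n (below v)))

  ∈-own-bag : ∀ v → v ∈ bag (rankIndex v)
  ∈-own-bag v = ∈-bag⁺ {rankIndex v} (≤-reflexive (sym (toℕ-rankIndex v)) , inj₁ (sym (toℕ-rankIndex v)))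

  ∈-neighbour-bag : ∀ {u v} → Graph.adj H u v ≡ true → rank u ≤ rank v → u ∈ bag (rankIndex v)
  ∈-neighbour-bag {u} {v} a le = ∈-bag⁺ {rankIndex v}
    (subst (rank u ≤_) (sym (toℕ-rankIndex v)) le , inj₂ (v , a , ≤-reflexive (toℕ-rankIndex v)))

  edge-in-bag : ∀ u v → Graph.adj H u v ≡ true → ∃ λ i → u ∈ bag i × v ∈ bag i
  edge-in-bag u v a with ≤-total (rank u) (rank v)
  ... | inj₁ le = rankIndex v , ∈-neighbour-bag a le , ∈-own-bag v
  ... | inj₂ le = rankIndex u , ∈-own-bag u , ∈-neighbour-bag (trans (Graph.sym H v u) a) le

  bag-contiguous : ∀ v (i j k : Fin (suc n)) → toℕ i ≤ toℕ j → toℕ j ≤ toℕ k → v ∈ bag i → v ∈ bag k → v ∈ bag j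
  bag-contiguous v i j k i≤j j≤k mi mk with ∈-bag⁻ {i} mi | ∈-bag⁻ {k} mk
  ... | v≤i , _ | _ , inj₁ e = ∈-bag⁺ {j} (≤-trans v≤i i≤j ,
          inj₁ (≤-antisym (≤-trans v≤i i≤j) (subst (toℕ j ≤_) (sym e) j≤k)))
  ... | v≤i , _ | _ , inj₂ (w , a , k≤w) = ∈-bag⁺ {j} (≤-trans v≤i i≤j , inj₂ (w , a , ≤-trans j≤k k≤w))

  pathDecomposition : PathDecomposition H
  pathDecomposition = record
    { m = suc n ; bag = bag ; cover = λ v → rankIndex v , ∈-own-bag v
    ; edges = edge-in-bag ; contig = bag-contiguous }

  inBag-descendant : ∀ {r u} → InBag r u → ∃ λ w → Ancestor F (φ u) (φ w) × r ≤ rank w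
  inBag-descendant {u = u} (_ , inj₁ e) = u , self , ≤-reflexive (sym e)
  inBag-descendant {u = u} (_ , inj₂ (w , a , r≤w)) with φ-edge u w a
  ... | inj₁ A = w , A , r≤w
  ... | inj₂ A with ancestor⇒prefix A
  ...   | β , e = u , self , ≤-trans r≤w (rank-≤ λ u<w → ++-≮ₗ (key w) β (subst (_<ₗ key w) e u<w))

  -- the descendants of u occupy the positions right after u, so every bag is a chain of ancestors
  inBag-chain : ∀ {r u v} → InBag r u → InBag r v → rank u ≤ rank v → Ancestor F (φ u) (φ v)
  inBag-chain {u = u} {v} iu iv u≤v with inBag-descendant iu
  ... | w , A , r≤w with ancestor⇒prefix A
  ...   | β , e = prefix⇒ancestor (φ v) (φ u) _ (proj₂ (prefix-squeeze (key u) (key v) β (rank-≤⁻ u≤v)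
          λ w<v → rank-≤⁻ (≤-trans (proj₁ iv) r≤w) (subst (_<ₗ key v) (sym e) w<v)))

  ancestor-level-injective : ∀ {u v} → Ancestor F (φ u) (φ v) → level (φ u) ≡ level (φ v) → u ≡ v
  ancestor-level-injective A e with ancestor-level F A
  ... | inj₁ φu≡φv = φ-injective φu≡φv
  ... | inj₂ u<v   = ⊥-elim (<-irrefl e u<v)

  inBag-level-injective : ∀ {r u v} → InBag r u → InBag r v → level (φ u) ≡ level (φ v) → u ≡ v
  inBag-level-injective {u = u} {v} iu iv e with ≤-total (rank u) (rank v)
  ... | inj₁ u≤v = ancestor-level-injective (inBag-chain iu iv u≤v) e
  ... | inj₂ v≤u = sym (ancestor-level-injective (inBag-chain iv iu v≤u) (sym e))

  levelIndex : Fin n → Fin (forestDepth F)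
  levelIndex u = fromℕ< (level∸1<depth F (φ u))

  ∣bag∣≤depth : ∀ r → ∣ bag r ∣ ≤ forestDepth F
  ∣bag∣≤depth r = ∣S∣≤-injectiveOn (bag r) levelIndex λ {u} {v} mu mv e →
    inBag-level-injective (∈-bag⁻ {r} mu) (∈-bag⁻ {r} mv)
      (∸-cancelʳ-≡ (level-positive F (φ u)) (level-positive F (φ v))
        (trans (sym (toℕ-fromℕ< _)) (trans (cong toℕ e) (toℕ-fromℕ< _))))

  pathDecomposition-width : pdWidth pathDecomposition ≤ forestDepth F ∸ 1
  pathDecomposition-width = ∸-monoˡ-≤ 1 (maxFin-least _ ∣bag∣≤depth)

pw≤depth∸1 : ∀ (H : Graph) {p N} (F : RootedForest N) (φ : Fin (∣V∣ H) → Fin N) → IsPw H p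
  → (∀ {a b} → φ a ≡ φ b → a ≡ b)
  → (∀ a b → Graph.adj H a b ≡ true → Ancestor F (φ a) (φ b) ⊎ Ancestor F (φ b) (φ a))
  → p ≤ forestDepth F ∸ 1
pw≤depth∸1 H F φ (_ , minimal) φ-injective φ-edge =
  ≤-trans (minimal pathDecomposition) pathDecomposition-width
  where open ForestPathDecomposition H F φ φ-injective φ-edge

∣bag∣≤width+1 : ∀ {H} (P : PathDecomposition H) i → ∣ PathDecomposition.bag P i ∣ ≤ 1 + pdWidth P
∣bag∣≤width+1 P i = ≤-trans (maxFin-upperBound _ i) (m≤n+m∸n _ 1)

tcpw<tctd : ∀ G {tcpw tctd} → IsTcpw G tcpw → IsTctd G tctd → Fin (∣V∣ G) → tcpw + 1 ≤ tctd
tcpw<tctd G {tcpw} (H₁ , Q₁ , pw) (H₂ , Q₂ , (F , tdF , refl) , _) x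
  with twinQuotient-embedding G H₁ H₂ Q₁ Q₂
... | φ , φ-injective , φ-edge = begin
  tcpw + 1               ≤⟨ +-monoˡ-≤ 1 (pw≤depth∸1 H₁ F φ pw φ-injective λ a b h → tdF (φ a) (φ b) (φ-edge a b h)) ⟩
  forestDepth F ∸ 1 + 1  ≡⟨ m∸n+n≡m (depth-positive F (TwinQuotient.q G H₂ Q₂ x)) ⟩
  forestDepth F          ∎
  where open ≤-Reasoning

someVertex : ∀ e → Fin (size e)
someVertex (intro _)       = fzero
someVertex (e₁ ⊕ e₂)       = someVertex e₁ ↑ˡ size e₂
someVertex (relabel _ _ e) = someVertex e
someVertex (join _ _ e)    = someVertex e

relabelLabel : ℕ → ℕ → ℕ → ℕ
relabelLabel i j ℓ = if ℓ ≡ᵇ i then j else ℓ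

intro-KExpr : ∀ {k ℓ} → 1 ≤ k → KExpr k (intro ℓ)
intro-KExpr {ℓ = ℓ} 1≤k = (ℓ ∷ [] , 1≤k , λ _ → hereˡ refl) , tt

relabelEach : List ℕ → ℕ → CExpr → CExpr
relabelEach []       j e = e
relabelEach (i ∷ is) j e = relabel i j (relabelEach is j e)

joinsWith : ℕ → List ℕ → CExpr → CExpr
joinsWith i []       e = e
joinsWith i (j ∷ js) e = join i j (joinsWith i js e)

relabelEach-linear : ∀ is j {e} → Linear e → Linear (relabelEach is j e)
relabelEach-linear []       j l = l
relabelEach-linear (i ∷ is) j l = relabelEach-linear is j l

joinsWith-linear : ∀ i js {e} → Linear e → Linear (joinsWith i js e)
joinsWith-linear i []       l = l
joinsWith-linear i (j ∷ js) l = joinsWith-linear i js l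

mergeLabel : List ℕ → ℕ → ℕ → ℕ
mergeLabel is j ℓ = if does (ℓ ∈ˡ? is) then j else ℓ

relabel-mergeLabel : ∀ i is j ℓ → relabelLabel i j (mergeLabel is j ℓ) ≡ mergeLabel (i ∷ is) j ℓ
relabel-mergeLabel i is j ℓ with does (ℓ ∈ˡ? is)
... | true with j ≡ᵇ i | ℓ ≡ᵇ i
...   | true  | true  = refl
...   | true  | false = refl
...   | false | true  = refl
...   | false | false = refl
relabel-mergeLabel i is j ℓ | false with ℓ ≡ᵇ i
...   | true  = refl
...   | false = refl

mergeLabel-∈ : ∀ is j ℓ {Ls} → ℓ ∈ˡ Ls → j ∈ˡ Ls → mergeLabel is j ℓ ∈ˡ Ls
mergeLabel-∈ is j ℓ ℓ∈ j∈ with does (ℓ ∈ˡ? is)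
... | true  = j∈
... | false = ℓ∈

mergeLabel-hit : ∀ {is ℓ} j → ℓ ∈ˡ is → mergeLabel is j ℓ ≡ j
mergeLabel-hit {is} {ℓ} j ℓ∈ rewrite dec-true (ℓ ∈ˡ? is) ℓ∈ = refl

mergeLabel-miss : ∀ {is ℓ} j → ¬ ℓ ∈ˡ is → mergeLabel is j ℓ ≡ ℓ
mergeLabel-miss {is} {ℓ} j ℓ∉ rewrite dec-false (ℓ ∈ˡ? is) ℓ∉ = refl

-- e evaluates to the labelled graph (lab, adj) induced on the vertices satisfying P
record Realises {n} (e : CExpr) (P : Fin n → Set) (lab : Fin n → ℕ) (adj : Fin n → Fin n → Bool) : Set where
  field
    vertex           : Fin (size e) → Fin n
    vertex-injective : ∀ {x y} → vertex x ≡ vertex y → x ≡ y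
    vertex-∈         : ∀ x → P (vertex x)
    vertex-onto      : ∀ {w} → P w → ∃ λ x → vertex x ≡ w
    lab-vertex       : ∀ x → LGraph.lab (eval e) x ≡ lab (vertex x)
    adj-vertex       : ∀ x y → LGraph.adj (eval e) x y ≡ adj (vertex x) (vertex y)

module _ {n : ℕ} where
  open Realises

  realises-cong : ∀ {e P P′ lab lab′ A A′} → Realises {n} e P lab A
    → (∀ {w} → P w → P′ w) → (∀ {w} → P′ w → P w)
    → (∀ {w} → P w → lab w ≡ lab′ w) → (∀ {w w′} → P w → P w′ → A w w′ ≡ A′ w w′)
    → Realises e P′ lab′ A′
  realises-cong R P⇒P′ P′⇒P lab≡ A≡ = record
    { vertex = vertex R ; vertex-injective = vertex-injective R
    ; vertex-∈ = λ x → P⇒P′ (vertex-∈ R x) ; vertex-onto = λ p → vertex-onto R (P′⇒P p)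
    ; lab-vertex = λ x → trans (lab-vertex R x) (lab≡ (vertex-∈ R x))
    ; adj-vertex = λ x y → trans (adj-vertex R x y) (A≡ (vertex-∈ R x) (vertex-∈ R y)) }

  realises-atMostLabels : ∀ {e P lab A} k (Ls : List ℕ) → Realises {n} e P lab A → length Ls ≤ k
    → (∀ {w} → P w → lab w ∈ˡ Ls) → AtMostLabels k (eval e)
  realises-atMostLabels k Ls R len lab∈ =
    Ls , len , λ x → subst (_∈ˡ Ls) (sym (lab-vertex R x)) (lab∈ (vertex-∈ R x))

  realises-intro : ∀ v ℓ → Realises {n} (intro ℓ) (_≡ v) (λ _ → ℓ) (λ _ _ → false)
  realises-intro v ℓ = record
    { vertex = λ _ → v ; vertex-injective = λ { {fzero} {fzero} _ → refl }
    ; vertex-∈ = λ _ → refl ; vertex-onto = λ e → fzero , sym e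
    ; lab-vertex = λ _ → refl ; adj-vertex = λ _ _ → refl }

  realises-relabel : ∀ {e P lab A} i j → Realises {n} e P lab A → Realises (relabel i j e) P (relabelLabel i j ∘ lab) A
  realises-relabel i j R = record
    { vertex = vertex R ; vertex-injective = vertex-injective R
    ; vertex-∈ = vertex-∈ R ; vertex-onto = vertex-onto R
    ; lab-vertex = λ x → cong (relabelLabel i j) (lab-vertex R x)
    ; adj-vertex = adj-vertex R }

  joinAdj : ℕ → ℕ → (Fin n → ℕ) → (Fin n → Fin n → Bool) → Fin n → Fin n → Bool
  joinAdj i j lab A w w′ = A w w′ ∨ ((lab w ≡ᵇ i) ∧ (lab w′ ≡ᵇ j)) ∨ ((lab w ≡ᵇ j) ∧ (lab w′ ≡ᵇ i))

  realises-join : ∀ {e P lab A} i j → Realises {n} e P lab A → Realises (join i j e) P lab (joinAdj i j lab A)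
  realises-join {e} {lab = lab} {A} i j R = record
    { vertex = vertex R ; vertex-injective = vertex-injective R
    ; vertex-∈ = vertex-∈ R ; vertex-onto = vertex-onto R
    ; lab-vertex = lab-vertex R
    ; adj-vertex = λ x y → adj-vertex′ x y }
    where
    adj-vertex′ : ∀ x y → LGraph.adj (eval (join i j e)) x y ≡ joinAdj i j lab A (vertex R x) (vertex R y)
    adj-vertex′ x y rewrite adj-vertex R x y | lab-vertex R x | lab-vertex R y = refl

  realises-⊕intro : ∀ {e P lab A lab′ A′ v} ℓ → Realises {n} e P lab A → ¬ P v
    → (∀ {w} → P w → lab′ w ≡ lab w) → lab′ v ≡ ℓ
    → (∀ {w w′} → P w → P w′ → A′ w w′ ≡ A w w′)
    → (∀ w → A′ w v ≡ false) → (∀ w → A′ v w ≡ false)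
    → Realises (e ⊕ intro ℓ) (λ w → P w ⊎ w ≡ v) lab′ A′
  realises-⊕intro {e} {P} {lab′ = lab′} {A′} {v} ℓ R ¬Pv lab′-old lab′-new A′-old A′-newˡ A′-newʳ = record
    { vertex = vertex′ ; vertex-injective = vertex′-injective ; vertex-∈ = vertex′-∈
    ; vertex-onto = vertex′-onto ; lab-vertex = lab-vertex′ ; adj-vertex = adj-vertex′ }
    where
    pick : Fin (size e) ⊎ Fin 1 → Fin n
    pick (inj₁ y) = vertex R y
    pick (inj₂ _) = v

    vertex′ : Fin (size e + 1) → Fin n
    vertex′ x = pick (splitAt (size e) x)

    old≢v : ∀ y → vertex R y ≢ v
    old≢v y eq = ¬Pv (subst P eq (vertex-∈ R y))

    pick-injective : ∀ a b → pick a ≡ pick b → a ≡ b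
    pick-injective (inj₁ a)     (inj₁ b)     eq = cong inj₁ (vertex-injective R eq)
    pick-injective (inj₁ a)     (inj₂ _)     eq = ⊥-elim (old≢v a eq)
    pick-injective (inj₂ _)     (inj₁ b)     eq = ⊥-elim (old≢v b (sym eq))
    pick-injective (inj₂ fzero) (inj₂ fzero) _  = refl

    vertex′-injective : ∀ {x y} → vertex′ x ≡ vertex′ y → x ≡ y
    vertex′-injective {x} {y} eq = begin
      x                         ≡⟨ join-splitAt (size e) 1 x ⟨
      fjoin (size e) 1 split-x  ≡⟨ cong (fjoin (size e) 1) (pick-injective split-x split-y eq) ⟩
      fjoin (size e) 1 split-y  ≡⟨ join-splitAt (size e) 1 y ⟩
      y                         ∎
      where
      open ≡-Reasoning
      split-x split-y : Fin (size e) ⊎ Fin 1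
      split-x = splitAt (size e) x
      split-y = splitAt (size e) y

    vertex′-∈ : ∀ x → P (vertex′ x) ⊎ vertex′ x ≡ v
    vertex′-∈ x with splitAt (size e) x
    ... | inj₁ y = inj₁ (vertex-∈ R y)
    ... | inj₂ _ = inj₂ refl

    vertex′-onto : ∀ {w} → P w ⊎ w ≡ v → ∃ λ x → vertex′ x ≡ w
    vertex′-onto (inj₁ p) with vertex-onto R p
    ... | y , refl = y ↑ˡ 1 , cong pick (splitAt-↑ˡ (size e) y 1)
    vertex′-onto (inj₂ refl) = size e ↑ʳ fzero , cong pick (splitAt-↑ʳ (size e) 1 fzero)

    lab-vertex′ : ∀ x → LGraph.lab (eval (e ⊕ intro ℓ)) x ≡ lab′ (vertex′ x)
    lab-vertex′ x with splitAt (size e) x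
    ... | inj₁ y = trans (lab-vertex R y) (sym (lab′-old (vertex-∈ R y)))
    ... | inj₂ _ = sym lab′-new

    adj-vertex′ : ∀ x y → LGraph.adj (eval (e ⊕ intro ℓ)) x y ≡ A′ (vertex′ x) (vertex′ y)
    adj-vertex′ x y with splitAt (size e) x | splitAt (size e) y
    ... | inj₁ a | inj₁ b = trans (adj-vertex R a b) (sym (A′-old (vertex-∈ R a) (vertex-∈ R b)))
    ... | inj₁ a | inj₂ _ = sym (A′-newˡ (vertex R a))
    ... | inj₂ _ | inj₁ b = sym (A′-newʳ (vertex R b))
    ... | inj₂ _ | inj₂ _ = sym (A′-newˡ v)

  joinsAdj : ℕ → List ℕ → (Fin n → ℕ) → (Fin n → Fin n → Bool) → Fin n → Fin n → Bool
  joinsAdj i []       lab A = A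
  joinsAdj i (j ∷ js) lab A = joinAdj i j lab (joinsAdj i js lab A)

  realises-relabelEach : ∀ {e P lab A} is j → Realises {n} e P lab A
    → Realises (relabelEach is j e) P (mergeLabel is j ∘ lab) A
  realises-relabelEach []       j R = realises-cong R (λ p → p) (λ p → p) (λ _ → refl) (λ _ _ → refl)
  realises-relabelEach (i ∷ is) j R = realises-cong (realises-relabel i j (realises-relabelEach is j R))
    (λ p → p) (λ p → p) (λ {w} _ → relabel-mergeLabel i is j _) (λ _ _ → refl)

  realises-joinsWith : ∀ {e P lab A} i js → Realises {n} e P lab A → Realises (joinsWith i js e) P lab (joinsAdj i js lab A)
  realises-joinsWith i []       R = R
  realises-joinsWith i (j ∷ js) R = realises-join i j (realises-joinsWith i js R)

  relabelEach-KExpr : ∀ {e P lab A} k (Ls : List ℕ) is j → Realises {n} e P lab A → KExpr k e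
    → length Ls ≤ k → (∀ {w} → P w → lab w ∈ˡ Ls) → j ∈ˡ Ls → KExpr k (relabelEach is j e)
  relabelEach-KExpr k Ls []       j R ke len lab∈ j∈ = ke
  relabelEach-KExpr k Ls (i ∷ is) j R ke len lab∈ j∈ =
      realises-atMostLabels k Ls (realises-relabelEach (i ∷ is) j R) len (λ p → mergeLabel-∈ (i ∷ is) j _ (lab∈ p) j∈)
    , relabelEach-KExpr k Ls is j R ke len lab∈ j∈

  joinsWith-KExpr : ∀ {e P lab A} k (Ls : List ℕ) i js → Realises {n} e P lab A → KExpr k e
    → length Ls ≤ k → (∀ {w} → P w → lab w ∈ˡ Ls) → All (i ≢_) js → KExpr k (joinsWith i js e)
  joinsWith-KExpr k Ls i []       R ke len lab∈ []          = ke
  joinsWith-KExpr k Ls i (j ∷ js) R ke len lab∈ (i≢j ∷ i≢js) =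
    realises-atMostLabels k Ls (realises-joinsWith i (j ∷ js) R) len lab∈ , i≢j , joinsWith-KExpr k Ls i js R ke len lab∈ i≢js

  module _ (i : ℕ) (lab : Fin n → ℕ) (A : Fin n → Fin n → Bool) where

    joinsAdj-unaffected : ∀ js {w w′} → lab w ≢ i → lab w′ ≢ i → joinsAdj i js lab A w w′ ≡ A w w′
    joinsAdj-unaffected []       _  _   = refl
    joinsAdj-unaffected (j ∷ js) {w} {w′} w≢ w′≢
      rewrite ≢⇒≡ᵇ-false w≢ | ≢⇒≡ᵇ-false w′≢ | ∧-zeroʳ (lab w ≡ᵇ j) | joinsAdj-unaffected js w≢ w′≢
      = ∨-identityʳ (A w w′)

    joinsAdj-toward : ∀ js {w v} → lab w ≢ i → lab v ≡ i
      → joinsAdj i js lab A w v ≡ A w v ∨ does (lab w ∈ˡ? js)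
    joinsAdj-toward []       {w} {v} _ _ = sym (∨-identityʳ (A w v))
    joinsAdj-toward (j ∷ js) {w} {v} w≢ v≡
      rewrite v≡ | ≢⇒≡ᵇ-false w≢ | ≡ᵇ-refl i | ∧-identityʳ (lab w ≡ᵇ j) | joinsAdj-toward js w≢ v≡
      = ∨-swap (A w v) _ _

    joinsAdj-from : ∀ js {w v} → lab w ≢ i → lab v ≡ i
      → joinsAdj i js lab A v w ≡ A v w ∨ does (lab w ∈ˡ? js)
    joinsAdj-from []       {w} {v} _ _ = sym (∨-identityʳ (A v w))
    joinsAdj-from (j ∷ js) {w} {v} w≢ v≡
      rewrite v≡ | ≢⇒≡ᵇ-false w≢ | ≡ᵇ-refl i | ∧-zeroʳ (i ≡ᵇ j) | ∨-identityʳ (lab w ≡ᵇ j) | joinsAdj-from js w≢ v≡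
      = ∨-swap (A v w) _ _

    joinsAdj-self : ∀ js {v} → lab v ≡ i → All (i ≢_) js → joinsAdj i js lab A v v ≡ A v v
    joinsAdj-self []       _  _             = refl
    joinsAdj-self (j ∷ js) {v} v≡ (i≢j ∷ i≢js)
      rewrite v≡ | ≢⇒≡ᵇ-false i≢j | ≡ᵇ-refl i | joinsAdj-self js v≡ i≢js = ∨-identityʳ (A v v)

  isolate : Fin n → (Fin n → Fin n → Bool) → Fin n → Fin n → Bool
  isolate v A w w′ = if does (w ≟ v) ∨ does (w′ ≟ v) then false else A w w′

  isolate-≢ : ∀ {v} A {w w′} → w ≢ v → w′ ≢ v → isolate v A w w′ ≡ A w w′
  isolate-≢ {v} A {w} {w′} w≢v w′≢v rewrite dec-false (w ≟ v) w≢v | dec-false (w′ ≟ v) w′≢v = refl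

  isolateˡ : ∀ v A w → isolate v A v w ≡ false
  isolateˡ v A w rewrite dec-true (v ≟ v) refl = refl

  isolateʳ : ∀ v A w → isolate v A w v ≡ false
  isolateʳ v A w rewrite dec-true (v ≟ v) refl | ∨-zeroʳ (does (w ≟ v)) = refl

realises-constructs : ∀ (G : Graph) {e P lab} → Realises {∣V∣ G} e P lab (Graph.adj G) → (∀ w → P w) → Constructs e G
realises-constructs G {e} R all = mk↔ₛ′ (vertex R) from to∘from from∘to , adj-vertex R
  where
  open Realises
  from : Fin (∣V∣ G) → Fin (size e)
  from w = proj₁ (vertex-onto R (all w))
  to∘from : ∀ w → vertex R (from w) ≡ w
  to∘from w = proj₂ (vertex-onto R (all w))
  from∘to : ∀ x → from (vertex R x) ≡ x
  from∘to x = vertex-injective R (to∘from (vertex R x))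

-- Linear clique-expressions from path decompositions of the twin quotient

-- label 0 marks vertices whose class has left the current bag, label 1 the vertex just added
classLabel : ∀ {K} → Fin K → ℕ
classLabel b = 2 + toℕ b

classLabel-injective : ∀ {K} {a b : Fin K} → classLabel a ≡ classLabel b → a ≡ b
classLabel-injective e = toℕ-injective (suc-injective (suc-injective e))

module TwinQuotientExpression (G H : Graph) (Q : IsTwinQuotient G H) (PD : PathDecomposition H)
  (k : ℕ) (bag-fits : ∀ i → 2 + ∣ PathDecomposition.bag PD i ∣ ≤ k) where
  open TwinQuotient G H Q
  open PathDecomposition PD

  private
    n K : ℕ
    n = ∣V∣ G
    K = ∣V∣ H
    adjG : Fin n → Fin n → Bool
    adjG = Graph.adj G

  classLabelAt : Fin m → Fin K → ℕ
  classLabelAt c b = if does (b ∈ˢ? bag c) then classLabel b else 0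

  classLabelAt-∈ : ∀ {c b} → b ∈ bag c → classLabelAt c b ≡ classLabel b
  classLabelAt-∈ {c} {b} b∈ rewrite dec-true (b ∈ˢ? bag c) b∈ = refl

  classLabelAt-∉ : ∀ {c b} → ¬ b ∈ bag c → classLabelAt c b ≡ 0
  classLabelAt-∉ {c} {b} b∉ rewrite dec-false (b ∈ˢ? bag c) b∉ = refl

  classLabelAt-injective : ∀ {c b b′} → classLabelAt c b ≡ classLabel b′ → b ≡ b′
  classLabelAt-injective {c} {b} e with b ∈ˢ? bag c
  ... | yes _ = classLabel-injective e

  label : Fin m → Fin n → ℕ
  label c w = classLabelAt c (q w)

  label≢1 : ∀ c w → label c w ≢ 1
  label≢1 c w with does (q w ∈ˢ? bag c)
  ... | true  = λ ()
  ... | false = λ ()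

  labelsOf : Fin m → List ℕ
  labelsOf c = 0 ∷ 1 ∷ tabulate (classLabel ∘ enumerate (bag c))

  labelsOf-fits : ∀ c → length (labelsOf c) ≤ k
  labelsOf-fits c = ≤-trans (≤-reflexive (cong (2 +_) (length-tabulate _))) (bag-fits c)

  classLabel∈labelsOf : ∀ {c b} → b ∈ bag c → classLabel b ∈ˡ labelsOf c
  classLabel∈labelsOf {c} b∈ with enumerate-onto (bag c) b∈
  ... | j , refl = thereˡ (thereˡ (∈ˡ.∈-tabulate⁺ j))

  label∈labelsOf : ∀ c w → label c w ∈ˡ labelsOf c
  label∈labelsOf c w with q w ∈ˢ? bag c
  ... | yes b∈ = classLabel∈labelsOf b∈
  ... | no  _  = hereˡ refl

  firstBag : Fin n → Fin m
  firstBag v = proj₁ (leastIndex (λ i → q v ∈ˢ? bag i) (cover (q v)))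

  firstBag-∈ : ∀ v → q v ∈ bag (firstBag v)
  firstBag-∈ v = proj₁ (proj₂ (leastIndex (λ i → q v ∈ˢ? bag i) (cover (q v))))

  firstBag-least : ∀ v {j} → q v ∈ bag j → toℕ (firstBag v) ≤ toℕ j
  firstBag-least v = proj₂ (proj₂ (leastIndex (λ i → q v ∈ˢ? bag i) (cover (q v))))

  still-in-bag : ∀ w {c i} → toℕ (firstBag w) ≤ toℕ c → toℕ c ≤ toℕ i → q w ∈ bag i → q w ∈ bag c
  still-in-bag w {c} {i} w≤c c≤i = contig (q w) (firstBag w) c i w≤c c≤i (firstBag-∈ w)

  neighbour-in-firstBag : ∀ {w v} → toℕ (firstBag w) ≤ toℕ (firstBag v) → adjG w v ≡ true
    → q w ∈ bag (firstBag v)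
  neighbour-in-firstBag {w} {v} w≤v a with q w ≟ q v
  ... | yes e = subst (_∈ bag (firstBag v)) (sym e) (firstBag-∈ v)
  ... | no ne with edges (q w) (q v) (adjG⇒adjH ne a)
  ...   | j , w∈j , v∈j = contig (q w) (firstBag w) (firstBag v) j w≤v (firstBag-least v v∈j) (firstBag-∈ w) w∈j

  HasNeighbourIn : Fin n → Fin K → Set
  HasNeighbourIn v b = ∃ λ u → q u ≡ b × adjG v u ≡ true

  HasNeighbourIn? : ∀ v → Decidable (HasNeighbourIn v)
  HasNeighbourIn? v b = any? λ u → (q u ≟ b) ×-dec (adjG v u ≟ᴮ true)

  neighbourLabels : Fin n → List ℕ
  neighbourLabels v = map classLabel (filter (HasNeighbourIn? v) (allFin K))

  -- joining label 1 with neighbourLabels v creates exactly the edges between v and earlier vertices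
  neighbourLabels-adj : ∀ {w v} → toℕ (firstBag w) ≤ toℕ (firstBag v) → w ≢ v
    → does (label (firstBag v) w ∈ˡ? neighbourLabels v) ≡ adjG w v
  neighbourLabels-adj {w} {v} w≤v w≢v = does≡ (label (firstBag v) w ∈ˡ? neighbourLabels v)
    (mk⇔ sound complete)
    where
    sound : label (firstBag v) w ∈ˡ neighbourLabels v → adjG w v ≡ true
    sound m with ∈ˡ.∈-map⁻ classLabel m
    ... | b , b∈ , lw≡b with ∈ˡ.∈-filter⁻ (HasNeighbourIn? v) {xs = allFin K} b∈
    ...   | _ , (u , qu≡b , v~u) = Twins-adj G (q≡⇒Twins (trans qu≡b (sym (classLabelAt-injective lw≡b))))
                                      (trans (Graph.sym G u v) v~u) (w≢v ∘ sym)
    complete : adjG w v ≡ true → label (firstBag v) w ∈ˡ neighbourLabels v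
    complete a = subst (_∈ˡ neighbourLabels v) (sym (classLabelAt-∈ (neighbour-in-firstBag w≤v a)))
      (∈ˡ.∈-map⁺ classLabel (∈ˡ.∈-filter⁺ (HasNeighbourIn? v) (∈ˡ.∈-allFin (q w))
        (w , refl , trans (Graph.sym G v w) a)))

  outsideClasses : Fin m → List (Fin K)
  outsideClasses i = filter (λ b → ¬? (b ∈ˢ? bag i)) (allFin K)

  outsideLabels : Fin m → List ℕ
  outsideLabels i = map classLabel (outsideClasses i)

  0∉outsideLabels : ∀ i → ¬ 0 ∈ˡ outsideLabels i
  0∉outsideLabels i m with ∈ˡ.∈-map⁻ classLabel m
  ... | _ , _ , ()

  classLabel∈outsideLabels : ∀ {i b} → ¬ b ∈ bag i → classLabel b ∈ˡ outsideLabels i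
  classLabel∈outsideLabels {i} {b} b∉ =
    ∈ˡ.∈-map⁺ classLabel (∈ˡ.∈-filter⁺ (λ b → ¬? (b ∈ˢ? bag i)) (∈ˡ.∈-allFin b) b∉)

  classLabel∉outsideLabels : ∀ {i b} → b ∈ bag i → ¬ classLabel b ∈ˡ outsideLabels i
  classLabel∉outsideLabels {i} b∈ m with ∈ˡ.∈-map⁻ classLabel m
  ... | b′ , b′∈ , e with refl ← classLabel-injective e =
    proj₂ (∈ˡ.∈-filter⁻ (λ b → ¬? (b ∈ˢ? bag i)) {xs = allFin K} b′∈) b∈

  kill-classLabel : ∀ i b → mergeLabel (outsideLabels i) 0 (classLabel b) ≡ classLabelAt i b
  kill-classLabel i b with b ∈ˢ? bag i
  ... | no  b∉ = mergeLabel-hit 0 (classLabel∈outsideLabels b∉)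
  ... | yes b∈ = mergeLabel-miss 0 (classLabel∉outsideLabels b∈)

  kill-label : ∀ {c i w} → toℕ (firstBag w) ≤ toℕ c → toℕ c ≤ toℕ i
    → mergeLabel (outsideLabels i) 0 (label c w) ≡ label i w
  kill-label {c} {i} {w} w≤c c≤i with q w ∈ˢ? bag c
  ... | yes _  = kill-classLabel i (q w)
  ... | no w∉c = trans (mergeLabel-miss 0 (0∉outsideLabels i))
                   (sym (classLabelAt-∉ (w∉c ∘ still-in-bag w w≤c c≤i)))

  record Stage (E : CExpr) (P : Fin n → Set) (c : Fin m) : Set where
    field
      realises : Realises E P (label c) adjG
      kexpr    : KExpr k E
      linear   : Linear E
      settled  : ∀ {w} → P w → toℕ (firstBag w) ≤ toℕ c

  stage-cong : ∀ {E P P′ c} → Stage E P c → (∀ {w} → P w → P′ w) → (∀ {w} → P′ w → P w) → Stage E P′ c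
  stage-cong S P⇒P′ P′⇒P = record
    { realises = realises-cong (Stage.realises S) P⇒P′ P′⇒P (λ _ → refl) (λ _ _ → refl)
    ; kexpr = Stage.kexpr S ; linear = Stage.linear S ; settled = Stage.settled S ∘ P′⇒P }

  1≤k : Fin m → 1 ≤ k
  1≤k c = ≤-trans (s≤s z≤n) (bag-fits c)

  start : ∀ v → Stage (intro (classLabel (q v))) (_≡ v) (firstBag v)
  start v = record
    { realises = realises-cong (realises-intro v _) (λ p → p) (λ p → p)
        (λ { refl → sym (classLabelAt-∈ (firstBag-∈ v)) })
        (λ { refl refl → sym (Graph.irrefl G v) })
    ; kexpr = intro-KExpr (1≤k (firstBag v))
    ; linear = tt
    ; settled = λ { refl → ≤-refl } }

  stepExpr : Fin n → CExpr → CExpr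
  stepExpr v E = relabel 1 (classLabel (q v))
    (joinsWith 1 (neighbourLabels v) (relabelEach (outsideLabels (firstBag v)) 0 E ⊕ intro 1))

  module Step {E P c} (S : Stage E P c) (v : Fin n) (¬Pv : ¬ P v) (c≤v : toℕ c ≤ toℕ (firstBag v)) where
    open Stage S

    private
      i : Fin m
      i = firstBag v

    P′ : Fin n → Set
    P′ w = P w ⊎ w ≡ v

    old≢v : ∀ {w} → P w → w ≢ v
    old≢v p refl = ¬Pv p

    killed : Realises (relabelEach (outsideLabels i) 0 E) P (label i) adjG
    killed = realises-cong (realises-relabelEach (outsideLabels i) 0 realises) (λ p → p) (λ p → p)
      (λ p → kill-label (settled p) c≤v) (λ _ _ → refl)

    lab₂ : Fin n → ℕ
    lab₂ = updateAt (label i) v (λ _ → 1)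

    lab₂-old : ∀ {w} → P w → lab₂ w ≡ label i w
    lab₂-old {w} p = updateAt-minimal w v (label i) (old≢v p)

    lab₂-new : lab₂ v ≡ 1
    lab₂-new = updateAt-updates v (label i)

    lab₂-old≢1 : ∀ {w} → P w → lab₂ w ≢ 1
    lab₂-old≢1 {w} p = subst (_≢ 1) (sym (lab₂-old p)) (label≢1 i w)

    A₂ : Fin n → Fin n → Bool
    A₂ = isolate v adjG

    added : Realises (relabelEach (outsideLabels i) 0 E ⊕ intro 1) P′ lab₂ A₂
    added = realises-⊕intro 1 killed ¬Pv lab₂-old lab₂-new
      (λ p p′ → isolate-≢ adjG (old≢v p) (old≢v p′)) (isolateʳ v adjG) (isolateˡ v adjG)

    1∉neighbourLabels : All (1 ≢_) (neighbourLabels v)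
    1∉neighbourLabels = All.map⁺ (All.universal (λ _ ()) _)

    final-label : ∀ {w} → P′ w → relabelLabel 1 (classLabel (q v)) (lab₂ w) ≡ label i w
    final-label {w} (inj₁ p) rewrite lab₂-old p | ≢⇒≡ᵇ-false (label≢1 i w) = refl
    final-label (inj₂ refl) rewrite lab₂-new = sym (classLabelAt-∈ (firstBag-∈ v))

    final-adj : ∀ {w w′} → P′ w → P′ w′ → joinsAdj 1 (neighbourLabels v) lab₂ A₂ w w′ ≡ adjG w w′
    final-adj (inj₁ p) (inj₁ p′) =
      trans (joinsAdj-unaffected 1 lab₂ A₂ (neighbourLabels v) (lab₂-old≢1 p) (lab₂-old≢1 p′))
        (isolate-≢ adjG (old≢v p) (old≢v p′))
    final-adj {w} (inj₁ p) (inj₂ refl)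
      rewrite joinsAdj-toward 1 lab₂ A₂ (neighbourLabels v) (lab₂-old≢1 p) lab₂-new | isolateʳ v adjG w | lab₂-old p
      = neighbourLabels-adj (≤-trans (settled p) c≤v) (old≢v p)
    final-adj {w′ = w′} (inj₂ refl) (inj₁ p′)
      rewrite joinsAdj-from 1 lab₂ A₂ (neighbourLabels v) (lab₂-old≢1 p′) lab₂-new | isolateˡ v adjG w′ | lab₂-old p′
      = trans (neighbourLabels-adj (≤-trans (settled p′) c≤v) (old≢v p′)) (Graph.sym G w′ v)
    final-adj (inj₂ refl) (inj₂ refl) =
      trans (joinsAdj-self 1 lab₂ A₂ (neighbourLabels v) lab₂-new 1∉neighbourLabels)
        (trans (isolateˡ v adjG v) (sym (Graph.irrefl G v)))

    realisesStep : Realises (stepExpr v E) P′ (label i) adjG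
    realisesStep =
      realises-cong (realises-relabel 1 (classLabel (q v)) (realises-joinsWith 1 (neighbourLabels v) added))
        (λ p → p) (λ p → p) final-label final-adj

    lab₂∈labelsOf : ∀ {w} → P′ w → lab₂ w ∈ˡ labelsOf i
    lab₂∈labelsOf {w} (inj₁ p) rewrite lab₂-old p = label∈labelsOf i w
    lab₂∈labelsOf (inj₂ refl) rewrite lab₂-new = thereˡ (hereˡ refl)

    kexprStep : KExpr k (stepExpr v E)
    kexprStep =
        realises-atMostLabels k (labelsOf i) realisesStep (labelsOf-fits i) (λ {w} _ → label∈labelsOf i w)
      , joinsWith-KExpr k (labelsOf i) 1 (neighbourLabels v) added kexprAdded (labelsOf-fits i) lab₂∈labelsOf
          1∉neighbourLabels
      where
      kexprKilled : KExpr k (relabelEach (outsideLabels i) 0 E)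
      kexprKilled = relabelEach-KExpr k (labelsOf c) (outsideLabels i) 0 realises kexpr (labelsOf-fits c)
        (λ {w} _ → label∈labelsOf c w) (hereˡ refl)
      kexprAdded : KExpr k (relabelEach (outsideLabels i) 0 E ⊕ intro 1)
      kexprAdded = realises-atMostLabels k (labelsOf i) added (labelsOf-fits i) lab₂∈labelsOf
        , kexprKilled , intro-KExpr (1≤k i)

    stage : Stage (stepExpr v E) P′ i
    stage = record
      { realises = realisesStep ; kexpr = kexprStep
      ; linear = joinsWith-linear 1 (neighbourLabels v) (relabelEach-linear (outsideLabels i) 0 linear , refl)
      ; settled = λ { (inj₁ p) → ≤-trans (settled p) c≤v ; (inj₂ refl) → ≤-refl } }

  extend : ∀ {E P c} vs → AllPairs (λ u w → toℕ (firstBag u) ≤ toℕ (firstBag w)) vs → Unique vs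
    → All (λ u → toℕ c ≤ toℕ (firstBag u)) vs → All (λ u → ¬ P u) vs → Stage E P c
    → ∃ λ E′ → ∃ λ c′ → Stage E′ (λ w → P w ⊎ w ∈ˡ vs) c′
  extend [] _ _ _ _ S = _ , _ , stage-cong S inj₁ λ { (inj₁ p) → p }
  extend {P = P} (v ∷ vs) (v≤vs ∷ sorted) (v≢vs ∷ unique) (c≤v ∷ _) (¬Pv ∷ fresh) S
    with extend vs sorted unique v≤vs fresh′ (Step.stage S v ¬Pv c≤v)
    where
    fresh′ : All (λ u → ¬ (P u ⊎ u ≡ v)) vs
    fresh′ = All.map (λ { (¬Pu , v≢u) → λ { (inj₁ Pu) → ¬Pu Pu ; (inj₂ u≡v) → v≢u (sym u≡v) } })
                     (All.zip (fresh , v≢vs))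
  ... | E′ , c′ , S′ = E′ , c′ , stage-cong S′ to from
    where
    to : ∀ {w} → (P w ⊎ w ≡ v) ⊎ w ∈ˡ vs → P w ⊎ w ∈ˡ v ∷ vs
    to (inj₁ (inj₁ p))    = inj₁ p
    to (inj₁ (inj₂ refl)) = inj₂ (hereˡ refl)
    to (inj₂ m)           = inj₂ (thereˡ m)
    from : ∀ {w} → P w ⊎ w ∈ˡ v ∷ vs → (P w ⊎ w ≡ v) ⊎ w ∈ˡ vs
    from (inj₁ p)              = inj₁ (inj₁ p)
    from (inj₂ (hereˡ refl))   = inj₁ (inj₂ refl)
    from (inj₂ (thereˡ m))     = inj₂ m

  module ByFirstBag = Data.List.Sort (On.decTotalOrder (≤ᶠ-decTotalOrder m) firstBag)

  order : List (Fin n)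
  order = ByFirstBag.sort (allFin n)

  order-complete : ∀ w → w ∈ˡ order
  order-complete w = ∈-resp-↭ (↭-sym (ByFirstBag.sort-↭ (allFin n))) (∈ˡ.∈-allFin w)

  order-unique : Unique order
  order-unique = Permutationₛ.Unique-resp-↭ (setoid (Fin n))
    (↭⇒↭ₛ (↭-sym (ByFirstBag.sort-↭ (allFin n)))) (allFin⁺ n)

  order-sorted : AllPairs (λ u w → toℕ (firstBag u) ≤ toℕ (firstBag w)) order
  order-sorted = Linked⇒AllPairs ≤-trans (ByFirstBag.sort-↗ (allFin n))

  linearExpression : Fin n → HasLinearKExpr k G
  linearExpression x with order | order-complete | order-unique | order-sorted
  ... | []     | complete | _ | _ with () ← complete x
  ... | v ∷ vs | complete | v≢vs ∷ unique | v≤vs ∷ sorted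
    with extend vs sorted unique v≤vs (All.map (λ v≢u u≡v → v≢u (sym u≡v)) v≢vs) (start v)
  ... | E , _ , S = E , Stage.kexpr S , Stage.linear S
    , realises-constructs G (Stage.realises S) λ w → case (complete w)
    where
    case : ∀ {w} → w ∈ˡ v ∷ vs → w ≡ v ⊎ w ∈ˡ vs
    case (hereˡ w≡v) = inj₁ w≡v
    case (thereˡ m)  = inj₂ m

IsCw⇒vertex : ∀ G {c} → IsCw G c → Fin (∣V∣ G)
IsCw⇒vertex G ((e , _ , iso , _) , _) = Inverse.to iso (someVertex e)

cw≤lcw : ∀ G {cw lcw} → IsCw G cw → IsLcw G lcw → cw ≤ lcw
cw≤lcw G {lcw = lcw} (_ , cw-least) ((e , ke , _ , c) , _) = cw-least lcw (e , ke , c)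

lcw≤tcpw+3 : ∀ G {lcw tcpw} → IsLcw G lcw → IsTcpw G tcpw → Fin (∣V∣ G) → lcw ≤ tcpw + 3
lcw≤tcpw+3 G {tcpw = tcpw} (_ , lcw-least) (H , Q , (PD , refl) , _) x =
  lcw-least (tcpw + 3) (TwinQuotientExpression.linearExpression G H Q PD (tcpw + 3) bag-fits x)
  where
  bag-fits : ∀ i → 2 + ∣ PathDecomposition.bag PD i ∣ ≤ pdWidth PD + 3
  bag-fits i = ≤-trans (+-monoʳ-≤ 2 (∣bag∣≤width+1 PD i)) (≤-reflexive (+-comm 3 (pdWidth PD)))

tctd≤td : ∀ G {tctd td} → IsTctd G tctd → IsTd G td → tctd ≤ td
tctd≤td G (H , Q , _ , tctd-least) ((F , tdF , refl) , _) with tdForest-twinQuotient G H Q F tdF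
... | F′ , tdF′ , F′≤F = ≤-trans (tctd-least F′ tdF′) F′≤F

theorem4p3 : (G : Graph) (cw lcw tcpw tctd td : ℕ)
    → IsCw G cw → IsLcw G lcw → IsTcpw G tcpw → IsTctd G tctd → IsTd G td
    → cw ≤ lcw × lcw ≤ tcpw + 3 × tcpw + 3 ≤ tctd + 2 × tctd + 2 ≤ td + 2
theorem4p3 G cw lcw tcpw tctd td hcw hlcw htcpw htctd htd =
    cw≤lcw G hcw hlcw
  , lcw≤tcpw+3 G hlcw htcpw x
  , subst (_≤ tctd + 2) (+-assoc tcpw 1 2) (+-monoˡ-≤ 2 (tcpw<tctd G htcpw htctd x))
  , +-monoˡ-≤ 2 (tctd≤td G htctd htd)
  where
  x : Fin (∣V∣ G)
  x = IsCw⇒vertex G hcw
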